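{- Let $D$ be an algebraically closed field and $d\ge 2$. In the Coefficient-Choosing Game with parameters $D$ and $d$, Wanda wins (regardless of who is Player I).
   Context: The Coefficient-Choosing Game with parameters an integral domain $D$ and a degree $d\ge 2$: one of two players, Wanda or Nora, is designated Player I and the other Player II. Starting with Player I, the players alternately choose the coefficients $a_0,\dots,a_d\in D$ of a polynomial $f(x)=a_dx^d+\cdots+a_1x+a_0$; on each turn the player picks any not-yet-chosen index $i$ (the order is not predetermined) and a value $a_i\in D$, subject to the rule that $a_d\neq 0$ and $a_0\neq 0$. When all $d+1$ coefficients are chosen, Wanda wins if $f$ has a root in the field of fractions of $D$, and Nora wins otherwise. -}

module Defs where

open import Level using (Level; _⊔_)
open import Algebra.Bundles using (CommutativeRing)
open import Data.Nat using (ℕ; zero; suc)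
open import Data.Fin using (Fin; zero; suc; fromℕ; _≟_)
open import Data.Maybe using (Maybe; just; nothing)
open import Data.Product using (Σ; ∃; _×_)
open import Relation.Nullary using (¬_; yes; no)
open import Relation.Binary.PropositionalEquality using (_≡_)

record Field (c ℓ : Level) : Set (Level.suc (c ⊔ ℓ)) where
  field
    commutativeRing : CommutativeRing c ℓ
  open CommutativeRing commutativeRing public
  field
    1≉0     : ¬ (1# ≈ 0#)
    inverse : ∀ x → ¬ (x ≈ 0#) → Σ Carrier λ y → (x * y) ≈ 1#

module _ {c ℓ : Level} (F : Field c ℓ) where
  open Field F using (Carrier; _≈_; _+_; _*_; 0#; 1#)

  eval : (n : ℕ) → (Fin n → Carrier) → Carrier → Carrier
  eval zero    co x = 0#
  eval (suc n) co x = co zero + x * eval n (λ i → co (suc i)) x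

  HasRoot : (n : ℕ) → (Fin n → Carrier) → Set (c ⊔ ℓ)
  HasRoot n co = ∃ λ x → eval n co x ≈ 0#

  -- algebraically closed: every polynomial of degree m ≥ 1
  -- (coefficients indexed 0..m, leading coefficient nonzero) has a root
  AlgebraicallyClosed : Set (c ⊔ ℓ)
  AlgebraicallyClosed =
    (m : ℕ) (co : Fin (suc (suc m)) → Carrier) →
    ¬ (co (fromℕ (suc m)) ≈ 0#) → HasRoot (suc (suc m)) co

data Player : Set where
  Wanda Nora : Player

module Game {c ℓ : Level} (F : Field c ℓ) (d : ℕ) where
  open Field F using (Carrier; _≈_; _+_; _*_; 0#; 1#)

  -- a game position: coefficient a_i is either chosen (just v) or not yet
  Position : Set c
  Position = Fin (suc d) → Maybe Carrier

  start : Position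
  start _ = nothing

  Legal : Position → Fin (suc d) → Carrier → Set (c ⊔ ℓ)
  Legal p i v =
    (p i ≡ nothing) × ((i ≡ zero → ¬ (v ≈ 0#)) × (i ≡ fromℕ d → ¬ (v ≈ 0#)))

  update : Position → Fin (suc d) → Carrier → Position
  update p i v j with j ≟ i
  ... | yes _ = just v
  ... | no  _ = p j

  -- final condition: the completed polynomial has a root in F
  -- (F is a field, so it is its own field of fractions)
  WandaWinsFinal : Position → Set (c ⊔ ℓ)
  WandaWinsFinal p =
    (co : Fin (suc d) → Carrier) → (∀ i → p i ≡ just (co i)) → HasRoot F (suc d) co

  -- WandaWins k pl p : with k moves remaining and player pl to move,
  -- Wanda has a winning strategy from position p.
  WandaWins : ℕ → Player → Position → Set (c ⊔ ℓ)
  WandaWins zero    _     p = WandaWinsFinal p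
  WandaWins (suc k) Wanda p =
    Σ (Fin (suc d)) λ i → Σ Carrier λ v → Legal p i v × WandaWins k Nora (update p i v)
  WandaWins (suc k) Nora  p =
    (i : Fin (suc d)) (v : Carrier) → Legal p i v → WandaWins k Wanda (update p i v)

  WandaWinsGame : Player → Set (c ⊔ ℓ)
  WandaWinsGame playerI = WandaWins (suc d) playerI start

module Submission where

-- Over an algebraically closed field Wanda wins without looking at Nora's
-- moves: every polynomial of degree d ≥ 1 with nonzero leading coefficient
-- has a root, and the rules of the game already force a_d ≠ 0.  So whatever
-- legal moves are made, the final polynomial has a root; Wanda only has to be
-- able to move at all, and she does so by setting any unchosen coefficient
-- to 1 (legal, since 1 ≠ 0).

open import Defs
open import Level using (Level)
open import Data.Nat using (ℕ; _≤_; zero; suc; s≤s; _+_)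
import Data.Nat.Properties as ℕ
open import Data.Fin using (Fin; zero; suc; fromℕ; _≟_)
open import Data.Fin.Properties using (suc-injective)
open import Data.Maybe using (Maybe; just; nothing)
open import Data.Maybe.Properties using (just-injective)
open import Data.Product using (∃; _,_)
open import Data.Empty using (⊥-elim)
open import Relation.Nullary using (¬_; yes; no)
open import Relation.Binary.PropositionalEquality
  using (_≡_; refl; sym; trans; cong; cong₂; subst)

module Unchosen {a} {A : Set a} where

  slot : Maybe A → ℕ
  slot nothing  = 1
  slot (just _) = 0

  unchosen : (n : ℕ) → (Fin n → Maybe A) → ℕ
  unchosen zero    f = 0
  unchosen (suc n) f = slot (f zero) + unchosen n (λ j → f (suc j))

  unchosen-cong : ∀ n (f g : Fin n → Maybe A) → (∀ j → f j ≡ g j) →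
                  unchosen n f ≡ unchosen n g
  unchosen-cong zero    f g f≗g = refl
  unchosen-cong (suc n) f g f≗g =
    cong₂ (λ x y → slot x + y)
      (f≗g zero) (unchosen-cong n _ _ (λ j → f≗g (suc j)))

  unchosen-empty : ∀ n → unchosen n (λ _ → nothing) ≡ n
  unchosen-empty zero    = refl
  unchosen-empty (suc n) = cong suc (unchosen-empty n)

  unchosen-fill : ∀ n (f g : Fin n → Maybe A) i v →
                  f i ≡ nothing → g i ≡ just v → (∀ j → ¬ (j ≡ i) → g j ≡ f j) →
                  suc (unchosen n g) ≡ unchosen n f
  unchosen-fill (suc n) f g zero v fi≡nothing gi≡just g≐f
    rewrite fi≡nothing | gi≡just =
    cong suc (unchosen-cong n _ _ (λ j → g≐f (suc j) (λ ())))
  unchosen-fill (suc n) f g (suc i) v fi≡nothing gi≡just g≐f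
    rewrite g≐f zero (λ ()) =
    trans (sym (ℕ.+-suc (slot (f zero)) _))
      (cong (slot (f zero) +_)
        (unchosen-fill n _ _ i v fi≡nothing gi≡just
          (λ j j≢i → g≐f (suc j) (λ sj≡si → j≢i (suc-injective sj≡si)))))

  unfilled-slot : ∀ n (f : Fin n → Maybe A) k → unchosen n f ≡ suc k →
                  ∃ λ i → f i ≡ nothing
  unfilled-slot (suc n) f k count with f zero in f0≡
  ... | nothing = zero , f0≡
  ... | just _ with unfilled-slot n (λ j → f (suc j)) k count
  ...   | i , fi≡nothing = suc i , fi≡nothing

open Unchosen

module WandaStrategy {c ℓ : Level} (F : Field c ℓ) (AC : AlgebraicallyClosed F)
                     (d-1 : ℕ) where
  open Field F using (_≈_; 0#; 1#; 1≉0)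

  -- the degree d = d-1 + 1 is at least 1, which is all the argument needs
  d : ℕ
  d = suc d-1

  open Game F d

  update-same : ∀ p i v → update p i v i ≡ just v
  update-same p i v with i ≟ i
  ... | yes _   = refl
  ... | no i≢i = ⊥-elim (i≢i refl)

  update-other : ∀ p i v j → ¬ (j ≡ i) → update p i v j ≡ p j
  update-other p i v j j≢i with j ≟ i
  ... | yes j≡i = ⊥-elim (j≢i j≡i)
  ... | no _    = refl

  remaining-after-move : ∀ p i v k → p i ≡ nothing →
                         unchosen (suc d) p ≡ suc k → unchosen (suc d) (update p i v) ≡ k
  remaining-after-move p i v k pi≡nothing count =
    ℕ.suc-injective
      (trans (unchosen-fill (suc d) p (update p i v) i v pi≡nothing
                (update-same p i v) (update-other p i v))
             count)

  LeadingNonzero : Position → Set _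
  LeadingNonzero p = ∀ v → p (fromℕ d) ≡ just v → ¬ (v ≈ 0#)

  -- the rule "a_d ≠ 0" makes every legal move preserve the invariant
  move-preserves : ∀ p i v → Legal p i v → LeadingNonzero p → LeadingNonzero (update p i v)
  move-preserves p i v (_ , _ , top≉0) inv w pd≡w with fromℕ d ≟ i
  ... | yes d≡i = λ w≈0 → top≉0 (sym d≡i) (subst (_≈ 0#) (sym (just-injective pd≡w)) w≈0)
  ... | no _    = inv w pd≡w

  completed-wins : ∀ p → LeadingNonzero p → WandaWinsFinal p
  completed-wins p inv co p≡co = AC d-1 co (inv (co (fromℕ d)) (p≡co (fromℕ d)))

  one-legal : ∀ p i → p i ≡ nothing → Legal p i 1#
  one-legal p i pi≡nothing = pi≡nothing , (λ _ → 1≉0) , (λ _ → 1≉0)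

  wins : ∀ k player p → unchosen (suc d) p ≡ k → LeadingNonzero p → WandaWins k player p
  wins zero    player p count inv = completed-wins p inv
  wins (suc k) Wanda  p count inv with unfilled-slot (suc d) p k count
  ... | i , pi≡nothing =
    i , 1# , one-legal p i pi≡nothing ,
    wins k Nora (update p i 1#) (remaining-after-move p i 1# k pi≡nothing count)
      (move-preserves p i 1# (one-legal p i pi≡nothing) inv)
  wins (suc k) Nora   p count inv i v legal@(pi≡nothing , _) =
    wins k Wanda (update p i v) (remaining-after-move p i v k pi≡nothing count)
      (move-preserves p i v legal inv)

theorem8p1 : {c ℓ : Level} (F : Field c ℓ) → AlgebraicallyClosed F →
    (d : ℕ) → 2 ≤ d → (playerI : Player) → Game.WandaWinsGame F d playerI
theorem8p1 F AC (suc d-1) (s≤s _) playerI =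
  WandaStrategy.wins F AC d-1 (suc (suc d-1)) playerI (λ _ → nothing)
    (unchosen-empty (suc (suc d-1))) (λ _ ())
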